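{- Let $G=(V,E)$ be a $P(2,1)$-graph containing a vertex $v$ of degree $3$ with at least two distinct neighbours. Then $v$ is admissible.
   Context: Graphs are finite multigraphs, loops allowed; a loop contributes $2$ to the degree. A graph is $(k,\ell)$-sparse if every subgraph $(V',E')$ with at least one edge has $|E'|\le k|V'|-\ell$, and $(k,\ell)$-tight if also $|E|=k|V|-\ell$. A $P(2,1)$-graph is a $(2,1)$-tight graph $G$ such that $G-e$ is $(2,2)$-tight for some edge $e$. A vertex $v$ is admissible if some inverse Henneberg operation removing $v$ yields a $P(2,1)$-graph, where the inverse Henneberg operations are: inverse 1a (delete a degree-2 vertex with two distinct neighbours), inverse 1b (delete a degree-2 vertex joined by two parallel edges to a single neighbour), inverse 2a (delete a degree-3 vertex with three distinct neighbours and add an edge between two of them), inverse 2b (delete a degree-3 vertex joined by one edge to $x$ and two parallel edges to $y\ne x$, and add an edge $xy$). -}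

module Defs where

open import Data.Nat using (ℕ; suc; _+_; _*_; _≤_; _≥_)
open import Data.Fin using (Fin; punchIn; punchOut; _≟_)
open import Data.Fin.Subset using (Subset; _∈_; ∣_∣)
open import Data.List using (List; []; _∷_; length; removeAt)
open import Data.List.Relation.Unary.All using (All)
open import Data.List.Relation.Binary.Sublist.Propositional using (_⊆_)
open import Data.List.Relation.Binary.Permutation.Propositional using (_↭_)
open import Data.Product using (_×_; _,_; Σ; ∃)
open import Relation.Nullary using (¬_; yes; no)
open import Relation.Binary.PropositionalEquality using (_≡_; _≢_; sym)

-- A finite multigraph with loops on the vertex set Fin m is given by a list
-- of edges (a multiset, duplicates = parallel edges); an edge (a , b) is an
-- unordered pair (orientation is irrelevant below); (a , a) is a loop.
EdgeList : ℕ → Set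
EdgeList m = List (Fin m × Fin m)

-- Neighbour multiset of v: one entry per edge-end at v, recording the other
-- end.  A loop at v contributes v twice.  Hence the degree is its length.
nbrs : ∀ {m} → Fin m → EdgeList m → List (Fin m)
nbrs v [] = []
nbrs v ((a , b) ∷ es) with a ≟ v | b ≟ v
... | yes _ | yes _ = v ∷ v ∷ nbrs v es
... | yes _ | no _  = b ∷ nbrs v es
... | no _  | yes _ = a ∷ nbrs v es
... | no _  | no _  = nbrs v es

deg : ∀ {m} → Fin m → EdgeList m → ℕ
deg v E = length (nbrs v E)

open import Data.List.Membership.Propositional as L using ()
Neighbour : ∀ {m} → EdgeList m → Fin m → Fin m → Set
Neighbour E v u = (u ≢ v) × (u L.∈ nbrs v E)

-- (k,ℓ)-sparse: every subgraph (V',E') with at least one edge satisfies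
-- |E'| ≤ k|V'| - ℓ  (written |E'| + ℓ ≤ k|V'| to avoid truncated subtraction).
Sparse : ℕ → ℕ → (m : ℕ) → EdgeList m → Set
Sparse k ℓ m E =
  (V' : Subset m) (E' : EdgeList m) → E' ⊆ E →
  All (λ e → (Data.Product.proj₁ e ∈ V') × (Data.Product.proj₂ e ∈ V')) E' →
  length E' ≥ 1 → length E' + ℓ ≤ k * ∣ V' ∣

Tight : ℕ → ℕ → (m : ℕ) → EdgeList m → Set
Tight k ℓ m E = Sparse k ℓ m E × (length E + ℓ ≡ k * m)

IsP21 : (m : ℕ) → EdgeList m → Set
IsP21 m E = Tight 2 1 m E × Σ (Fin (length E)) (λ i → Tight 2 2 m (removeAt E i))

deleteVertex : ∀ {n} → Fin (suc n) → EdgeList (suc n) → EdgeList n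
deleteVertex v [] = []
deleteVertex v ((a , b) ∷ es) with a ≟ v | b ≟ v
... | no a≢v | no b≢v =
  (punchOut {i = v} (λ p → a≢v (sym p)) , punchOut {i = v} (λ p → b≢v (sym p)))
    ∷ deleteVertex v es
... | _ | _ = deleteVertex v es

-- Neighbours are written as
-- punchIn v x for x a vertex of H (so they are automatically ≠ v).
data InverseHenneberg (n : ℕ) (E : EdgeList (suc n)) (v : Fin (suc n))
       : EdgeList n → Set where
  inv1a : (x y : Fin n) → x ≢ y →
          nbrs v E ↭ (punchIn v x ∷ punchIn v y ∷ []) →
          InverseHenneberg n E v (deleteVertex v E)
  inv1b : (y : Fin n) →
          nbrs v E ↭ (punchIn v y ∷ punchIn v y ∷ []) →
          InverseHenneberg n E v (deleteVertex v E)
  -- inverse 2a: degree 3, three distinct neighbours x,y,z; add edge xy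
  -- (any two of the three may be chosen, by reordering x y z)
  inv2a : (x y z : Fin n) → x ≢ y → x ≢ z → y ≢ z →
          nbrs v E ↭ (punchIn v x ∷ punchIn v y ∷ punchIn v z ∷ []) →
          InverseHenneberg n E v ((x , y) ∷ deleteVertex v E)
  inv2b : (x y : Fin n) → x ≢ y →
          nbrs v E ↭ (punchIn v x ∷ punchIn v y ∷ punchIn v y ∷ []) →
          InverseHenneberg n E v ((x , y) ∷ deleteVertex v E)

Admissible : (n : ℕ) → EdgeList (suc n) → Fin (suc n) → Set
Admissible n E v = ∃ λ (H : EdgeList n) → InverseHenneberg n E v H × IsP21 n H

module Submission where

-- Fix an edge e₀ with G − e₀ (2,2)-tight.  Sparsity is rephrased through
-- vertex sets only: i_X(E) counts the edges spanned by X, and "(k,ℓ)-sparse"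
-- becomes "i_X(E) ≥ 1 ⇒ i_X(E) + ℓ ≤ k|X|".  For X ⊆ V(G − v) write
-- f(X) = i_X(G − e₀) and d(X) for the number of edges from v into X.
-- The parity of loop ends shows that v has no loop, so its neighbour
-- multiset is {x, y, z} ⊆ V(G − v), and we take H = (G − v) + xy.
--   * If e₀ is incident to v, then H − xy = G − e₀ − v is (2,2)-tight.
--   * Otherwise H − e₀ = (G − e₀ − v) + xy is (2,2)-tight unless some set X
--     with f(X) + 2 = 2|X| contains x and y.  Sparsity of X + v gives
--     f(X) + d(X) ≤ 2|X|, which excludes this in case 2b (d(X) = 3), and in
--     case 2a a tight set through x, y and one through x, z would uncross,
--     by supermodularity of f, into a contradiction.
-- In both cases adding back the removed edge makes H a P(2,1)-graph.

open import Defs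
open import Data.Nat using (ℕ; zero; suc; _+_; _*_; _≤_; z≤n; s≤s; _≤?_)
open import Data.Nat.Properties hiding (_≟_)
open import Data.Nat.ListAction using (sum)
open import Data.Nat.ListAction.Properties using (sum-↭)
open import Algebra.Properties.CommutativeSemigroup +-commutativeSemigroup using (interchange; x∙yz≈y∙xz; xy∙z≈xz∙y)
open import Data.Bool using (Bool; true; false; _∧_; _∨_) renaming (_≟_ to _≟ᵇ_)
open import Data.Bool.Properties using (∧-zeroʳ; ∧-identityʳ; ∨-zeroʳ)
open import Data.Fin using (Fin; zero; suc; punchIn; punchOut; _≟_)
open import Data.Fin.Properties using (punchIn-punchOut)
open import Data.Fin.Subset using (Subset; _∈_; ∣_∣; _∪_; _∩_)
open import Data.Fin.Subset.Properties using (anySubset?; x∈p⇒∣p-x∣<∣p∣)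
open import Data.Vec using ([]; _∷_; lookup; insertAt; zipWith)
open import Data.Vec.Properties using (lookup⇒[]=; []=⇒lookup; lookup-zipWith; insertAt-lookup; insertAt-punchIn)
open import Data.List using (List; []; _∷_; length; removeAt; map) renaming (lookup to edgeAt)
open import Data.List.Properties using (length-removeAt′)
open import Data.List.Relation.Unary.All using (All; []; _∷_)
open import Data.List.Relation.Unary.Any using (here; there)
open import Data.List.Membership.Propositional using () renaming (_∈_ to _∈ᴸ_)
open import Data.List.Relation.Binary.Sublist.Propositional using (_⊆_; []; _∷ʳ_; _∷_)
open import Data.List.Relation.Binary.Permutation.Propositional using (_↭_; ↭-refl; ↭-trans; ↭-reflexive; prep; swap)
open import Data.List.Relation.Binary.Permutation.Propositional.Properties using (map⁺)
open import Data.Product using (_×_; _,_; Σ; ∃; ∃₂; proj₁; proj₂)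
open import Data.Sum using (_⊎_; inj₁; inj₂)
open import Data.Empty using (⊥; ⊥-elim)
open import Relation.Nullary using (¬_; Dec; yes; no; contradiction)
open import Relation.Binary.PropositionalEquality

⟦_⟧ : Bool → ℕ
⟦ true ⟧  = 1
⟦ false ⟧ = 0

⟦⟧≤1 : ∀ b → ⟦ b ⟧ ≤ 1
⟦⟧≤1 true  = s≤s z≤n
⟦⟧≤1 false = z≤n

spans : ∀ {m} → Subset m → Fin m × Fin m → Bool
spans X (a , b) = lookup X a ∧ lookup X b

induced : ∀ {m} → Subset m → EdgeList m → ℕ
induced X []      = 0
induced X (e ∷ E) = ⟦ spans X e ⟧ + induced X E

-- (k,ℓ)-sparsity stated on vertex sets: it suffices to test, for each X,
-- the largest subgraph on X, which has i_X(E) edges.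
CountSparse : ℕ → ℕ → (m : ℕ) → EdgeList m → Set
CountSparse k ℓ m E = (X : Subset m) → 1 ≤ induced X E → induced X E + ℓ ≤ k * ∣ X ∣

Within : ∀ {m} → Subset m → Fin m × Fin m → Set
Within X e = (proj₁ e ∈ X) × (proj₂ e ∈ X)

spannedEdges : ∀ {m} → Subset m → EdgeList m → EdgeList m
spannedEdges X [] = []
spannedEdges X ((a , b) ∷ E) with lookup X a | lookup X b
... | true | true = (a , b) ∷ spannedEdges X E
... | _    | _    = spannedEdges X E

spannedEdges-subgraph : ∀ {m} (X : Subset m) (E : EdgeList m) →
  spannedEdges X E ⊆ E × All (Within X) (spannedEdges X E) × length (spannedEdges X E) ≡ induced X E
spannedEdges-subgraph X [] = [] , [] , refl
spannedEdges-subgraph X ((a , b) ∷ E) with lookup X a in a∈X | lookup X b in b∈X | spannedEdges-subgraph X E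
... | true  | true  | sub , within , len =
  refl ∷ sub , (lookup⇒[]= a X a∈X , lookup⇒[]= b X b∈X) ∷ within , cong suc len
... | true  | false | sub , within , len = _ ∷ʳ sub , within , len
... | false | true  | sub , within , len = _ ∷ʳ sub , within , len
... | false | false | sub , within , len = _ ∷ʳ sub , within , len

subgraph-bound : ∀ {m} (X : Subset m) {E' E : EdgeList m} → E' ⊆ E → All (Within X) E' → length E' ≤ induced X E
subgraph-bound X [] _ = z≤n
subgraph-bound X (e ∷ʳ sub) within = ≤-trans (subgraph-bound X sub within) (m≤n+m _ ⟦ spans X e ⟧)
subgraph-bound X (_∷_ {x = (a , b)} refl sub) ((a∈X , b∈X) ∷ within)
  rewrite []=⇒lookup a∈X | []=⇒lookup b∈X = s≤s (subgraph-bound X sub within)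

sparse⇒countSparse : ∀ {k ℓ m E} → Sparse k ℓ m E → CountSparse k ℓ m E
sparse⇒countSparse {k} {ℓ} {m} {E} sparse X h with spannedEdges-subgraph X E
... | sub , within , len =
  subst (λ t → t + ℓ ≤ k * ∣ X ∣) len (sparse X (spannedEdges X E) sub within (subst (1 ≤_) (sym len) h))

countSparse⇒sparse : ∀ {k ℓ m E} → CountSparse k ℓ m E → Sparse k ℓ m E
countSparse⇒sparse {k} {ℓ} sparse X E' sub within h =
  ≤-trans (+-monoˡ-≤ ℓ (subgraph-bound X sub within)) (sparse X (≤-trans h (subgraph-bound X sub within)))

induced-removeAt : ∀ {m} (X : Subset m) (E : EdgeList m) (j : Fin (length E)) →
  induced X (removeAt E j) + ⟦ spans X (edgeAt E j) ⟧ ≡ induced X E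
induced-removeAt X (e ∷ E) zero    = +-comm (induced X E) ⟦ spans X e ⟧
induced-removeAt X (e ∷ E) (suc j) =
  trans (+-assoc ⟦ spans X e ⟧ _ _) (cong (⟦ spans X e ⟧ +_) (induced-removeAt X E j))

member⇒nonempty : ∀ {m} (X : Subset m) (x : Fin m) → lookup X x ≡ true → 1 ≤ ∣ X ∣
member⇒nonempty X x x∈X = ≤-trans (s≤s z≤n) (x∈p⇒∣p-x∣<∣p∣ (lookup⇒[]= x X x∈X))

spans⇒nonempty : ∀ {m} (X : Subset m) (E : EdgeList m) → 1 ≤ induced X E → 1 ≤ ∣ X ∣
spans⇒nonempty X ((a , b) ∷ E) h with lookup X a in a∈X
... | true  = member⇒nonempty X a a∈X
... | false = spans⇒nonempty X E h

addEdge-sparse : ∀ {m} (L : EdgeList m) (x y : Fin m) → CountSparse 2 2 m L →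
  (∀ X → lookup X x ≡ true → lookup X y ≡ true → induced X L + 3 ≤ 2 * ∣ X ∣) →
  CountSparse 2 2 m ((x , y) ∷ L)
addEdge-sparse L x y sparse slack X h with lookup X x in x∈X | lookup X y in y∈X
... | true  | true  = subst (_≤ 2 * ∣ X ∣) (+-suc (induced X L) 2) (slack X x∈X y∈X)
... | true  | false = sparse X h
... | false | _     = sparse X h

restoreEdge-sparse : ∀ {m} (H : EdgeList m) (j : Fin (length H)) →
  CountSparse 2 2 m (removeAt H j) → CountSparse 2 1 m H
restoreEdge-sparse H j sparse X h =
  subst (λ t → t + 1 ≤ 2 * ∣ X ∣) (induced-removeAt X H j) (bound (1 ≤? rest))
  where
  rest = induced X (removeAt H j)
  edge = ⟦ spans X (edgeAt H j) ⟧
  open ≤-Reasoning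
  bound : Dec (1 ≤ rest) → (rest + edge) + 1 ≤ 2 * ∣ X ∣
  bound (yes rest≥1) = begin
    (rest + edge) + 1 ≡⟨ +-assoc rest edge 1 ⟩
    rest + (edge + 1) ≤⟨ +-monoʳ-≤ rest (+-monoˡ-≤ 1 (⟦⟧≤1 _)) ⟩
    rest + 2          ≤⟨ sparse X rest≥1 ⟩
    2 * ∣ X ∣         ∎
  bound (no rest≱1) = begin
    (rest + edge) + 1 ≡⟨ cong (λ t → (t + edge) + 1) (n<1⇒n≡0 (≰⇒> rest≱1)) ⟩
    edge + 1          ≤⟨ +-monoˡ-≤ 1 (⟦⟧≤1 _) ⟩
    2 * 1             ≤⟨ *-monoʳ-≤ 2 (spans⇒nonempty X H h) ⟩
    2 * ∣ X ∣         ∎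

P21-from-edgeDeletion : ∀ {n} (H : EdgeList n) (j : Fin (length H)) →
  length (removeAt H j) + 2 ≡ 2 * n → CountSparse 2 2 n (removeAt H j) → IsP21 n H
P21-from-edgeDeletion {n} H j count sparse =
  (countSparse⇒sparse {2} {1} {n} {H} (restoreEdge-sparse H j sparse) , countH) ,
  j , (countSparse⇒sparse {2} {2} {n} {removeAt H j} sparse , count)
  where
  countH : length H + 1 ≡ 2 * n
  countH = trans (cong (_+ 1) (length-removeAt′ H j)) (trans (sym (+-suc _ 1)) count)

∣insertAt∣ : ∀ {n} (X : Subset n) (v : Fin (suc n)) (b : Bool) → ∣ insertAt X v b ∣ ≡ ⟦ b ⟧ + ∣ X ∣
∣insertAt∣ X         zero    true  = refl
∣insertAt∣ X         zero    false = refl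
∣insertAt∣ (true ∷ X)  (suc v) b = trans (cong suc (∣insertAt∣ X v b)) (sym (+-suc ⟦ b ⟧ _))
∣insertAt∣ (false ∷ X) (suc v) b = ∣insertAt∣ X v b

∣∪∣+∣∩∣ : ∀ {n} (A B : Subset n) → ∣ A ∪ B ∣ + ∣ A ∩ B ∣ ≡ ∣ A ∣ + ∣ B ∣
∣∪∣+∣∩∣ [] [] = refl
∣∪∣+∣∩∣ (true ∷ A) (true ∷ B) =
  cong suc (trans (+-suc _ _) (trans (cong suc (∣∪∣+∣∩∣ A B)) (sym (+-suc _ _))))
∣∪∣+∣∩∣ (true ∷ A)  (false ∷ B) = cong suc (∣∪∣+∣∩∣ A B)
∣∪∣+∣∩∣ (false ∷ A) (true ∷ B)  = trans (cong suc (∣∪∣+∣∩∣ A B)) (sym (+-suc _ _))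
∣∪∣+∣∩∣ (false ∷ A) (false ∷ B) = ∣∪∣+∣∩∣ A B

∪-memberˡ : ∀ {n} (A B : Subset n) x → lookup A x ≡ true → lookup (A ∪ B) x ≡ true
∪-memberˡ A B x x∈A = trans (lookup-zipWith _∨_ x A B) (cong (_∨ lookup B x) x∈A)

∪-memberʳ : ∀ {n} (A B : Subset n) x → lookup B x ≡ true → lookup (A ∪ B) x ≡ true
∪-memberʳ A B x x∈B =
  trans (lookup-zipWith _∨_ x A B) (trans (cong (lookup A x ∨_) x∈B) (∨-zeroʳ (lookup A x)))

∩-member : ∀ {n} (A B : Subset n) x → lookup A x ≡ true → lookup B x ≡ true → lookup (A ∩ B) x ≡ true
∩-member A B x x∈A x∈B = trans (lookup-zipWith _∧_ x A B) (cong₂ _∧_ x∈A x∈B)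

insertAt-zipWith : ∀ {n} (f : Bool → Bool → Bool) (A B : Subset n) (v : Fin (suc n)) →
  insertAt (zipWith f A B) v (f false false) ≡ zipWith f (insertAt A v false) (insertAt B v false)
insertAt-zipWith f A       B       zero    = refl
insertAt-zipWith f (a ∷ A) (b ∷ B) (suc v) = cong (f a b ∷_) (insertAt-zipWith f A B v)

-- X ↦ i_X(E) is supermodular.  For a single edge with end-memberships
-- p, q (in A) and r, s (in B) this is a truth table.
spans-supermodular : ∀ p q r s →
  ⟦ p ∧ q ⟧ + ⟦ r ∧ s ⟧ ≤ ⟦ (p ∨ r) ∧ (q ∨ s) ⟧ + ⟦ (p ∧ r) ∧ (q ∧ s) ⟧
spans-supermodular true  true  r     s     = ≤-refl
spans-supermodular true  false false s     = z≤n
spans-supermodular true  false true  false = z≤n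
spans-supermodular true  false true  true  = ≤-refl
spans-supermodular false q     false s     = z≤n
spans-supermodular false q     true  false = z≤n
spans-supermodular false false true  true  = ≤-refl
spans-supermodular false true  true  true  = ≤-refl

induced-supermodular : ∀ {m} (A B : Subset m) (E : EdgeList m) →
  induced A E + induced B E ≤ induced (A ∪ B) E + induced (A ∩ B) E
induced-supermodular A B [] = z≤n
induced-supermodular A B ((a , b) ∷ E) =
  subst₂ _≤_ (interchange ⟦ spans A (a , b) ⟧ ⟦ spans B (a , b) ⟧ (induced A E) (induced B E))
             (interchange ⟦ spans (A ∪ B) (a , b) ⟧ ⟦ spans (A ∩ B) (a , b) ⟧ (induced (A ∪ B) E) (induced (A ∩ B) E))
             (+-mono-≤ edge (induced-supermodular A B E))
  where
  edge : ⟦ spans A (a , b) ⟧ + ⟦ spans B (a , b) ⟧ ≤ ⟦ spans (A ∪ B) (a , b) ⟧ + ⟦ spans (A ∩ B) (a , b) ⟧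
  edge rewrite lookup-zipWith _∨_ a A B | lookup-zipWith _∨_ b A B
             | lookup-zipWith _∧_ a A B | lookup-zipWith _∧_ b A B
    = spans-supermodular (lookup A a) (lookup A b) (lookup B a) (lookup B b)

-- A vertex set X of G − v is seen in G as insertAt X v false, and X + v as
-- insertAt X v true.  Lookups away from v see X itself.
lookup-insertAt-≢ : ∀ {n} (X : Subset n) (v : Fin (suc n)) (b : Bool) {a : Fin (suc n)} (v≢a : v ≢ a) →
  lookup (insertAt X v b) a ≡ lookup X (punchOut v≢a)
lookup-insertAt-≢ X v b v≢a =
  trans (cong (lookup (insertAt X v b)) (sym (punchIn-punchOut v≢a))) (insertAt-punchIn X v b (punchOut v≢a))

lookup-insertAt-≡ : ∀ {n} (X : Subset n) (v : Fin (suc n)) (b : Bool) {a : Fin (suc n)} → a ≡ v →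
  lookup (insertAt X v b) a ≡ b
lookup-insertAt-≡ X v b refl = insertAt-lookup X v b

spans-punchOut : ∀ {n} (X : Subset n) (v : Fin (suc n)) {a b : Fin (suc n)} (a≢v : a ≢ v) (b≢v : b ≢ v) →
  spans X (punchOut {i = v} (λ p → a≢v (sym p)) , punchOut {i = v} (λ p → b≢v (sym p)))
    ≡ spans (insertAt X v false) (a , b)
spans-punchOut X v a≢v b≢v =
  sym (cong₂ _∧_ (lookup-insertAt-≢ X v false (λ p → a≢v (sym p))) (lookup-insertAt-≢ X v false (λ p → b≢v (sym p))))

spans-at-v : ∀ {n} (X : Subset n) (v : Fin (suc n)) (e : Fin (suc n) × Fin (suc n)) →
  (proj₁ e ≡ v) ⊎ (proj₂ e ≡ v) → spans (insertAt X v false) e ≡ false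
spans-at-v X v (a , b) (inj₁ a≡v) rewrite lookup-insertAt-≡ X v false a≡v = refl
spans-at-v X v (a , b) (inj₂ b≡v)
  rewrite lookup-insertAt-≡ X v false b≡v = ∧-zeroʳ (lookup (insertAt X v false) a)

spans-off-v : ∀ {n} (X : Subset n) (v : Fin (suc n)) (e : Fin (suc n) × Fin (suc n)) →
  proj₁ e ≢ v → proj₂ e ≢ v → spans (insertAt X v true) e ≡ spans (insertAt X v false) e
spans-off-v X v (a , b) a≢v b≢v =
  cong₂ _∧_ (trans (lookup-insertAt-≢ X v true (λ p → a≢v (sym p))) (sym (lookup-insertAt-≢ X v false (λ p → a≢v (sym p)))))
            (trans (lookup-insertAt-≢ X v true (λ p → b≢v (sym p))) (sym (lookup-insertAt-≢ X v false (λ p → b≢v (sym p)))))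

induced-deleteVertex : ∀ {n} (X : Subset n) (v : Fin (suc n)) (E : EdgeList (suc n)) →
  induced X (deleteVertex v E) ≡ induced (insertAt X v false) E
induced-deleteVertex X v [] = refl
induced-deleteVertex X v ((a , b) ∷ E) with a ≟ v | b ≟ v
... | no a≢v | no b≢v = cong₂ _+_ (cong ⟦_⟧ (spans-punchOut X v a≢v b≢v)) (induced-deleteVertex X v E)
... | yes a≡v | _ =
  trans (induced-deleteVertex X v E)
        (cong (λ t → ⟦ t ⟧ + induced (insertAt X v false) E) (sym (spans-at-v X v (a , b) (inj₁ a≡v))))
... | no _ | yes b≡v =
  trans (induced-deleteVertex X v E)
        (cong (λ t → ⟦ t ⟧ + induced (insertAt X v false) E) (sym (spans-at-v X v (a , b) (inj₂ b≡v))))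

length-deleteVertex : ∀ {n} (v : Fin (suc n)) (E : EdgeList (suc n)) → All (_≢ v) (nbrs v E) →
  length E ≡ length (deleteVertex v E) + deg v E
length-deleteVertex v [] _ = refl
length-deleteVertex v ((a , b) ∷ E) loopFree with a ≟ v | b ≟ v
length-deleteVertex v ((a , b) ∷ E) (v≢v ∷ _) | yes _ | yes _ = ⊥-elim (v≢v refl)
length-deleteVertex v ((a , b) ∷ E) (_ ∷ loopFree) | yes _ | no _ =
  trans (cong suc (length-deleteVertex v E loopFree)) (sym (+-suc _ _))
length-deleteVertex v ((a , b) ∷ E) (_ ∷ loopFree) | no _ | yes _ =
  trans (cong suc (length-deleteVertex v E loopFree)) (sym (+-suc _ _))
length-deleteVertex v ((a , b) ∷ E) loopFree | no _ | no _ = cong suc (length-deleteVertex v E loopFree)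

neighboursIn : ∀ {m} → Subset m → List (Fin m) → ℕ
neighboursIn Y us = sum (map (λ u → ⟦ lookup Y u ⟧) us)

induced-with-v : ∀ {n} (X : Subset n) (v : Fin (suc n)) (E : EdgeList (suc n)) → All (_≢ v) (nbrs v E) →
  induced (insertAt X v true) E ≡ induced (insertAt X v false) E + neighboursIn (insertAt X v true) (nbrs v E)
induced-with-v X v [] _ = refl
induced-with-v X v ((a , b) ∷ E) loopFree with a ≟ v | b ≟ v
induced-with-v X v ((a , b) ∷ E) (v≢v ∷ _) | yes _ | yes _ = ⊥-elim (v≢v refl)
induced-with-v X v ((a , b) ∷ E) (_ ∷ loopFree) | yes a≡v | no _
  rewrite lookup-insertAt-≡ X v true a≡v | lookup-insertAt-≡ X v false a≡v =
  trans (cong (⟦ lookup (insertAt X v true) b ⟧ +_) (induced-with-v X v E loopFree))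
        (x∙yz≈y∙xz ⟦ lookup (insertAt X v true) b ⟧ (induced (insertAt X v false) E) (neighboursIn (insertAt X v true) (nbrs v E)))
induced-with-v X v ((a , b) ∷ E) (_ ∷ loopFree) | no _ | yes b≡v
  rewrite lookup-insertAt-≡ X v true b≡v | lookup-insertAt-≡ X v false b≡v
        | ∧-zeroʳ (lookup (insertAt X v false) a) | ∧-identityʳ (lookup (insertAt X v true) a) =
  trans (cong (⟦ lookup (insertAt X v true) a ⟧ +_) (induced-with-v X v E loopFree))
        (x∙yz≈y∙xz ⟦ lookup (insertAt X v true) a ⟧ (induced (insertAt X v false) E) (neighboursIn (insertAt X v true) (nbrs v E)))
induced-with-v X v ((a , b) ∷ E) loopFree | no a≢v | no b≢v =
  trans (cong₂ _+_ (cong ⟦_⟧ (spans-off-v X v (a , b) a≢v b≢v)) (induced-with-v X v E loopFree))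
        (sym (+-assoc ⟦ spans (insertAt X v false) (a , b) ⟧ (induced (insertAt X v false) E) (neighboursIn (insertAt X v true) (nbrs v E))))

survivesDeletion : ∀ {n} (v : Fin (suc n)) (E : EdgeList (suc n)) (i : Fin (length E)) →
  proj₁ (edgeAt E i) ≢ v → proj₂ (edgeAt E i) ≢ v →
  Σ (Fin (length (deleteVertex v E))) λ j →
    ∀ X → spans X (edgeAt (deleteVertex v E) j) ≡ spans (insertAt X v false) (edgeAt E i)
survivesDeletion v ((a , b) ∷ E) zero a≢v b≢v with a ≟ v | b ≟ v
... | yes a≡v | _       = ⊥-elim (a≢v a≡v)
... | no _    | yes b≡v = ⊥-elim (b≢v b≡v)
... | no a≢v′ | no b≢v′ = zero , λ X → spans-punchOut X v a≢v′ b≢v′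
survivesDeletion v ((a , b) ∷ E) (suc i) a≢v b≢v with survivesDeletion v E i a≢v b≢v | a ≟ v | b ≟ v
... | j , same | no _  | no _  = suc j , same
... | j , same | yes _ | _     = j , same
... | j , same | no _  | yes _ = j , same

uncrossing : ∀ {f₁ f₂ f∪ f∩ s₁ s₂ s∪ s∩ : ℕ} →
  f₁ + 2 ≡ 2 * s₁ → f₂ + 2 ≡ 2 * s₂ → f₁ + f₂ ≤ f∪ + f∩ → s∪ + s∩ ≡ s₁ + s₂ →
  f∪ + 3 ≤ 2 * s∪ → f∩ + 2 ≤ 2 * s∩ → ⊥
uncrossing {f₁} {f₂} {f∪} {f∩} {s₁} {s₂} {s∪} {s∩} tight₁ tight₂ super sizes bound∪ bound∩ =
  1+n≰n (begin
    suc ((f∪ + f∩) + 4)   ≡⟨ regroup∪∩ ⟩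
    (f∪ + 3) + (f∩ + 2)   ≤⟨ +-mono-≤ bound∪ bound∩ ⟩
    2 * s∪ + 2 * s∩       ≡⟨ sym (*-distribˡ-+ 2 s∪ s∩) ⟩
    2 * (s∪ + s∩)         ≡⟨ cong (2 *_) sizes ⟩
    2 * (s₁ + s₂)         ≡⟨ *-distribˡ-+ 2 s₁ s₂ ⟩
    2 * s₁ + 2 * s₂       ≡⟨ cong₂ _+_ (sym tight₁) (sym tight₂) ⟩
    (f₁ + 2) + (f₂ + 2)   ≡⟨ regroup₁₂ ⟩
    (f₁ + f₂) + 4         ≤⟨ +-monoˡ-≤ 4 super ⟩
    (f∪ + f∩) + 4         ∎)
  where
  open ≤-Reasoning
  regroup∪∩ : suc ((f∪ + f∩) + 4) ≡ (f∪ + 3) + (f∩ + 2)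
  regroup∪∩ = sym (trans (interchange f∪ 3 f∩ 2) (+-suc (f∪ + f∩) 4))
  regroup₁₂ : (f₁ + 2) + (f₂ + 2) ≡ (f₁ + f₂) + 4
  regroup₁₂ = interchange f₁ 2 f₂ 2

module Reduction {n : ℕ} (E : EdgeList (suc n)) (v : Fin (suc n))
    (i₀ : Fin (length E)) (sparse₀ : CountSparse 2 2 (suc n) (removeAt E i₀))
    (countE : length E + 1 ≡ 2 * suc n)
    (loopFree : All (_≢ v) (nbrs v E)) (deg3 : deg v E ≡ 3) where

  E₀ : EdgeList (suc n)
  E₀ = removeAt E i₀

  e₀ : Fin (suc n) × Fin (suc n)
  e₀ = edgeAt E i₀

  D : EdgeList n
  D = deleteVertex v E

  f : Subset n → ℕ
  f X = induced (insertAt X v false) E₀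

  d : Subset n → ℕ
  d X = neighboursIn (insertAt X v true) (nbrs v E)

  countD : length D + 2 ≡ 2 * n
  countD = suc-injective (suc-injective (begin
    suc (suc (length D + 2)) ≡⟨ regroup (length D) ⟩
    (length D + 3) + 1       ≡⟨ cong (λ t → (length D + t) + 1) (sym deg3) ⟩
    (length D + deg v E) + 1 ≡⟨ cong (_+ 1) (sym (length-deleteVertex v E loopFree)) ⟩
    length E + 1             ≡⟨ countE ⟩
    2 * suc n                ≡⟨ *-suc 2 n ⟩
    suc (suc (2 * n))        ∎))
    where
    open ≡-Reasoning
    regroup : ∀ k → suc (suc (k + 2)) ≡ (k + 3) + 1
    regroup k = sym (trans (+-assoc k 3 1) (trans (+-suc k 3) (cong suc (+-suc k 2))))

  f-sparse : ∀ X → 1 ≤ f X → f X + 2 ≤ 2 * ∣ X ∣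
  f-sparse X h = subst (λ t → f X + 2 ≤ 2 * t) (∣insertAt∣ X v false) (sparse₀ (insertAt X v false) h)

  f-sparse-member : ∀ X x → lookup X x ≡ true → f X + 2 ≤ 2 * ∣ X ∣
  f-sparse-member X x x∈X with 1 ≤? f X
  ... | yes h = f-sparse X h
  ... | no h rewrite n<1⇒n≡0 (≰⇒> h) = *-monoʳ-≤ 2 (member⇒nonempty X x x∈X)

  sparse-via-f : (L : EdgeList n) → (∀ X → induced X L ≡ f X) → CountSparse 2 2 n L
  sparse-via-f L same X h =
    subst (λ t → t + 2 ≤ 2 * ∣ X ∣) (sym (same X)) (f-sparse X (subst (1 ≤_) (same X) h))

  e₀-position : ((proj₁ e₀ ≡ v) ⊎ (proj₂ e₀ ≡ v)) ⊎ ((proj₁ e₀ ≢ v) × (proj₂ e₀ ≢ v))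
  e₀-position with proj₁ e₀ ≟ v | proj₂ e₀ ≟ v
  ... | yes p | _     = inj₁ (inj₁ p)
  ... | no _  | yes q = inj₁ (inj₂ q)
  ... | no p  | no q  = inj₂ (p , q)

  incident-P21 : (proj₁ e₀ ≡ v) ⊎ (proj₂ e₀ ≡ v) → ∀ x y → IsP21 n ((x , y) ∷ D)
  incident-P21 e₀-at-v x y = P21-from-edgeDeletion ((x , y) ∷ D) zero countD (sparse-via-f D inducedD)
    where
    inducedD : ∀ X → induced X D ≡ f X
    inducedD X = begin
      induced X D                                     ≡⟨ induced-deleteVertex X v E ⟩
      induced (insertAt X v false) E                  ≡⟨ sym (induced-removeAt _ E i₀) ⟩
      f X + ⟦ spans (insertAt X v false) e₀ ⟧         ≡⟨ cong (λ t → f X + ⟦ t ⟧) (spans-at-v X v e₀ e₀-at-v) ⟩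
      f X + 0                                         ≡⟨ +-identityʳ (f X) ⟩
      f X                                             ∎
      where open ≡-Reasoning

  module Avoiding (e₀₁≢v : proj₁ e₀ ≢ v) (e₀₂≢v : proj₂ e₀ ≢ v) where

    induced-plus-v : ∀ X → induced (insertAt X v true) E₀ ≡ f X + d X
    induced-plus-v X = +-cancelʳ-≡ ⟦ spans X⁰ e₀ ⟧ _ _ (begin
      induced X¹ E₀ + ⟦ spans X⁰ e₀ ⟧    ≡⟨ cong (λ t → induced X¹ E₀ + ⟦ t ⟧) (sym (spans-off-v X v e₀ e₀₁≢v e₀₂≢v)) ⟩
      induced X¹ E₀ + ⟦ spans X¹ e₀ ⟧    ≡⟨ induced-removeAt X¹ E i₀ ⟩
      induced X¹ E                       ≡⟨ induced-with-v X v E loopFree ⟩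
      induced X⁰ E + d X                 ≡⟨ cong (_+ d X) (sym (induced-removeAt X⁰ E i₀)) ⟩
      (f X + ⟦ spans X⁰ e₀ ⟧) + d X      ≡⟨ xy∙z≈xz∙y (f X) _ (d X) ⟩
      (f X + d X) + ⟦ spans X⁰ e₀ ⟧      ∎)
      where
      open ≡-Reasoning
      X⁰ X¹ : Subset (suc n)
      X⁰ = insertAt X v false
      X¹ = insertAt X v true

    f+d-bound : ∀ X → 1 ≤ d X → f X + d X ≤ 2 * ∣ X ∣
    f+d-bound X h = +-cancelʳ-≤ 2 _ _ (subst₂ _≤_ (cong (_+ 2) (induced-plus-v X)) size+v
      (sparse₀ (insertAt X v true) (≤-trans h (≤-trans (m≤n+m (d X) (f X)) (≤-reflexive (sym (induced-plus-v X)))))))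
      where
      size+v : 2 * ∣ insertAt X v true ∣ ≡ 2 * ∣ X ∣ + 2
      size+v = trans (cong (2 *_) (∣insertAt∣ X v true)) (trans (*-suc 2 ∣ X ∣) (+-comm 2 (2 * ∣ X ∣)))

    NoTightSet : Fin n → Fin n → Set
    NoTightSet x y = ∀ X → lookup X x ≡ true → lookup X y ≡ true → f X + 3 ≤ 2 * ∣ X ∣

    avoiding-P21 : ∀ x y → NoTightSet x y → IsP21 n ((x , y) ∷ D)
    avoiding-P21 x y noTight with survivesDeletion v E i₀ e₀₁≢v e₀₂≢v
    ... | j , same = P21-from-edgeDeletion ((x , y) ∷ D) (suc j) count
          (addEdge-sparse D₀ x y (sparse-via-f D₀ inducedD₀)
            (λ X x∈X y∈X → subst (λ t → t + 3 ≤ 2 * ∣ X ∣) (sym (inducedD₀ X)) (noTight X x∈X y∈X)))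
      where
      D₀ : EdgeList n
      D₀ = removeAt D j
      count : suc (length D₀) + 2 ≡ 2 * n
      count = trans (cong (_+ 2) (sym (length-removeAt′ D j))) countD
      inducedD₀ : ∀ X → induced X D₀ ≡ f X
      inducedD₀ X = +-cancelʳ-≡ ⟦ spans X (edgeAt D j) ⟧ _ _ (begin
        induced X D₀ + ⟦ spans X (edgeAt D j) ⟧           ≡⟨ induced-removeAt X D j ⟩
        induced X D                                       ≡⟨ induced-deleteVertex X v E ⟩
        induced (insertAt X v false) E                    ≡⟨ sym (induced-removeAt _ E i₀) ⟩
        f X + ⟦ spans (insertAt X v false) e₀ ⟧           ≡⟨ cong (λ t → f X + ⟦ t ⟧) (sym (same X)) ⟩
        f X + ⟦ spans X (edgeAt D j) ⟧                    ∎)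
        where open ≡-Reasoning

    d-value : ∀ x y z → nbrs v E ↭ (punchIn v x ∷ punchIn v y ∷ punchIn v z ∷ []) → ∀ X →
      d X ≡ ⟦ lookup X x ⟧ + (⟦ lookup X y ⟧ + (⟦ lookup X z ⟧ + 0))
    d-value x y z nbrs↭ X = trans (sum-↭ (map⁺ _ nbrs↭))
      (cong₂ _+_ (member x) (cong₂ _+_ (member y) (cong (_+ 0) (member z))))
      where
      member : ∀ u → ⟦ lookup (insertAt X v true) (punchIn v u) ⟧ ≡ ⟦ lookup X u ⟧
      member u = cong ⟦_⟧ (insertAt-punchIn X v true u)

    -- Case 2b (edges vx, vy, vy): a set containing x and y receives d = 3.
    noTightSet-2b : ∀ x y → nbrs v E ↭ (punchIn v x ∷ punchIn v y ∷ punchIn v y ∷ []) → NoTightSet x y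
    noTightSet-2b x y nbrs↭ X x∈X y∈X =
      subst (λ t → f X + t ≤ 2 * ∣ X ∣) d≡3 (f+d-bound X (subst (1 ≤_) (sym d≡3) (s≤s z≤n)))
      where
      d≡3 : d X ≡ 3
      d≡3 = trans (d-value x y y nbrs↭ X) (cong₂ (λ s t → ⟦ s ⟧ + (⟦ t ⟧ + (⟦ t ⟧ + 0))) x∈X y∈X)

    tight : ∀ X → 2 ≤ d X → ¬ (f X + 3 ≤ 2 * ∣ X ∣) → f X + 2 ≡ 2 * ∣ X ∣
    tight X d≥2 noSlack = ≤-antisym
      (≤-trans (+-monoʳ-≤ (f X) d≥2) (f+d-bound X (≤-trans (s≤s z≤n) d≥2)))
      (≤-pred (subst (suc (2 * ∣ X ∣) ≤_) (+-suc (f X) 2) (≰⇒> noSlack)))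

    TightThrough : Fin n → Fin n → Subset n → Set
    TightThrough x y X = (lookup X x ≡ true) × (lookup X y ≡ true) × ¬ (f X + 3 ≤ 2 * ∣ X ∣)

    tightThrough? : ∀ x y X → Dec (TightThrough x y X)
    tightThrough? x y X with lookup X x ≟ᵇ true | lookup X y ≟ᵇ true | f X + 3 ≤? 2 * ∣ X ∣
    ... | yes x∈X | yes y∈X | no noSlack = yes (x∈X , y∈X , noSlack)
    ... | no x∉X  | _       | _          = no λ (x∈X , _) → x∉X x∈X
    ... | yes _   | no y∉X  | _          = no λ (_ , y∈X , _) → y∉X y∈X
    ... | yes _   | yes _   | yes slack  = no λ (_ , _ , noSlack) → noSlack slack

    noWitness⇒noTightSet : ∀ x y → ¬ ∃ (TightThrough x y) → NoTightSet x y
    noWitness⇒noTightSet x y none X x∈X y∈X with f X + 3 ≤? 2 * ∣ X ∣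
    ... | yes slack  = slack
    ... | no noSlack = ⊥-elim (none (X , x∈X , y∈X , noSlack))

    -- There are finitely many vertex sets, so either alternative can be decided.
    noTightSet-or-witness : ∀ x y → NoTightSet x y ⊎ ∃ (TightThrough x y)
    noTightSet-or-witness x y with anySubset? (tightThrough? x y)
    ... | yes witness = inj₂ witness
    ... | no none     = inj₁ (noWitness⇒noTightSet x y none)

    -- Case 2a (distinct x, y, z): tight sets through {x,y} and {x,z} cannot
    -- both exist, since their union receives d = 3 and their intersection
    -- contains x.
    noTightSet-2a : ∀ x y z → nbrs v E ↭ (punchIn v x ∷ punchIn v y ∷ punchIn v z ∷ []) →
      NoTightSet x y ⊎ NoTightSet x z
    noTightSet-2a x y z nbrs↭ with noTightSet-or-witness x y | noTightSet-or-witness x z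
    ... | inj₁ none | _ = inj₁ none
    ... | inj₂ _ | inj₁ none = inj₂ none
    ... | inj₂ (X₁ , x∈X₁ , y∈X₁ , noSlack₁) | inj₂ (X₂ , x∈X₂ , z∈X₂ , noSlack₂) =
      ⊥-elim (uncrossing {f X₁} {f X₂} {f U} {f I} {∣ X₁ ∣} {∣ X₂ ∣} {∣ U ∣} {∣ I ∣}
        (tight X₁ (two X₁ x∈X₁ y∈X₁) noSlack₁)
        (tight X₂ (two′ X₂ x∈X₂ z∈X₂) noSlack₂)
        supermodular
        (∣∪∣+∣∩∣ X₁ X₂)
        (subst (λ t → f U + t ≤ 2 * ∣ U ∣) d≡3 (f+d-bound U (subst (1 ≤_) (sym d≡3) (s≤s z≤n))))
        (f-sparse-member I x (∩-member X₁ X₂ x x∈X₁ x∈X₂)))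
      where
      U I : Subset n
      U = X₁ ∪ X₂
      I = X₁ ∩ X₂
      two : ∀ X → lookup X x ≡ true → lookup X y ≡ true → 2 ≤ d X
      two X x∈X y∈X rewrite d-value x y z nbrs↭ X | x∈X | y∈X = s≤s (s≤s z≤n)
      two′ : ∀ X → lookup X x ≡ true → lookup X z ≡ true → 2 ≤ d X
      two′ X x∈X z∈X rewrite d-value x y z nbrs↭ X | x∈X | z∈X = s≤s (m≤n+m 1 _)
      d≡3 : d U ≡ 3
      d≡3 rewrite d-value x y z nbrs↭ U
                | ∪-memberˡ X₁ X₂ x x∈X₁ | ∪-memberˡ X₁ X₂ y y∈X₁ | ∪-memberʳ X₁ X₂ z z∈X₂ = refl
      supermodular : f X₁ + f X₂ ≤ f U + f I
      supermodular = subst₂ (λ S T → f X₁ + f X₂ ≤ induced S E₀ + induced T E₀)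
        (sym (insertAt-zipWith _∨_ X₁ X₂ v)) (sym (insertAt-zipWith _∧_ X₁ X₂ v))
        (induced-supermodular (insertAt X₁ v false) (insertAt X₂ v false) E₀)

  admissible-2b : ∀ x y → x ≢ y → nbrs v E ↭ (punchIn v x ∷ punchIn v y ∷ punchIn v y ∷ []) → Admissible n E v
  admissible-2b x y x≢y nbrs↭ = _ , inv2b x y x≢y nbrs↭ , P21
    where
    P21 : IsP21 n ((x , y) ∷ D)
    P21 with e₀-position
    ... | inj₁ e₀-at-v = incident-P21 e₀-at-v x y
    ... | inj₂ (p , q) = Avoiding.avoiding-P21 p q x y (Avoiding.noTightSet-2b p q x y nbrs↭)

  admissible-2a : ∀ x y z → x ≢ y → x ≢ z → y ≢ z →
    nbrs v E ↭ (punchIn v x ∷ punchIn v y ∷ punchIn v z ∷ []) → Admissible n E v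
  admissible-2a x y z x≢y x≢z y≢z nbrs↭ with e₀-position
  ... | inj₁ e₀-at-v = _ , inv2a x y z x≢y x≢z y≢z nbrs↭ , incident-P21 e₀-at-v x y
  ... | inj₂ (p , q) with Avoiding.noTightSet-2a p q x y z nbrs↭
  ...   | inj₁ noTight = _ , inv2a x y z x≢y x≢z y≢z nbrs↭ , Avoiding.avoiding-P21 p q x y noTight
  ...   | inj₂ noTight = _ , inv2a x z y x≢z x≢y (λ z≡y → y≢z (sym z≡y)) nbrs↭′ , Avoiding.avoiding-P21 p q x z noTight
    where
    nbrs↭′ : nbrs v E ↭ (punchIn v x ∷ punchIn v z ∷ punchIn v y ∷ [])
    nbrs↭′ = ↭-trans nbrs↭ (prep _ (swap _ _ ↭-refl))

  admissible : ∀ x y z → nbrs v E ≡ (punchIn v x ∷ punchIn v y ∷ punchIn v z ∷ []) →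
    (x ≡ y → x ≡ z → ⊥) → Admissible n E v
  admissible x y z nbrs≡ notAllEqual with x ≟ y | x ≟ z | y ≟ z
  ... | no x≢y | no x≢z | no y≢z = admissible-2a x y z x≢y x≢z y≢z (↭-reflexive nbrs≡)
  ... | no x≢y | no _   | yes refl = admissible-2b x y x≢y (↭-reflexive nbrs≡)
  ... | no x≢y | yes refl | _ =
    admissible-2b y x (λ y≡x → x≢y (sym y≡x)) (↭-trans (↭-reflexive nbrs≡) (swap _ _ ↭-refl))
  ... | yes refl | no x≢z | _ =
    admissible-2b z x (λ z≡x → x≢z (sym z≡x))
      (↭-trans (↭-reflexive nbrs≡) (↭-trans (prep _ (swap _ _ ↭-refl)) (swap _ _ ↭-refl)))
  ... | yes x≡y | yes x≡z | _ = ⊥-elim (notAllEqual x≡y x≡z)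

occurrences : ∀ {m} → Fin m → List (Fin m) → ℕ
occurrences v [] = 0
occurrences v (u ∷ us) with u ≟ v
... | yes _ = suc (occurrences v us)
... | no _  = occurrences v us

occurrences-here : ∀ {m} (v : Fin m) us → occurrences v (v ∷ us) ≡ suc (occurrences v us)
occurrences-here v us with v ≟ v
... | yes _  = refl
... | no v≢v = ⊥-elim (v≢v refl)

occurrences-other : ∀ {m} (v u : Fin m) us → u ≢ v → occurrences v (u ∷ us) ≡ occurrences v us
occurrences-other v u us u≢v with u ≟ v
... | yes u≡v = ⊥-elim (u≢v u≡v)
... | no _    = refl

-- A loop at v puts v twice into its neighbour list, so v occurs evenly often.
occurrences-even : ∀ {m} (v : Fin m) (E : EdgeList m) → ∃ λ k → occurrences v (nbrs v E) ≡ k + k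
occurrences-even v [] = 0 , refl
occurrences-even v ((a , b) ∷ E) with a ≟ v | b ≟ v | occurrences-even v E
... | yes _ | yes _   | k , even = suc k ,
  trans (occurrences-here v (v ∷ nbrs v E))
        (cong suc (trans (occurrences-here v (nbrs v E)) (trans (cong suc even) (sym (+-suc k k)))))
... | yes _ | no b≢v  | k , even = k , trans (occurrences-other v b _ b≢v) even
... | no a≢v | yes _  | k , even = k , trans (occurrences-other v a _ a≢v) even
... | no _  | no _    | k , even = k , even

occurrences≤length : ∀ {m} (v : Fin m) us → occurrences v us ≤ length us
occurrences≤length v [] = z≤n
occurrences≤length v (u ∷ us) with u ≟ v
... | yes _ = s≤s (occurrences≤length v us)
... | no _  = m≤n⇒m≤1+n (occurrences≤length v us)

occurrences<length : ∀ {m} {v a : Fin m} {us} → a ∈ᴸ us → a ≢ v → suc (occurrences v us) ≤ length us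
occurrences<length {v = v} {us = u ∷ us} (here refl) a≢v =
  subst (_≤ length (u ∷ us)) (cong suc (sym (occurrences-other v u us a≢v))) (s≤s (occurrences≤length v us))
occurrences<length {v = v} {us = u ∷ us} (there a∈us) a≢v with u ≟ v
... | yes _ = s≤s (occurrences<length a∈us a≢v)
... | no _  = m≤n⇒m≤1+n (occurrences<length a∈us a≢v)

occurrences+2≤length : ∀ {m} {v a b : Fin m} {us} → a ≢ b → a ∈ᴸ us → b ∈ᴸ us → a ≢ v → b ≢ v →
  suc (suc (occurrences v us)) ≤ length us
occurrences+2≤length a≢b (here refl) (here refl) _ _ = ⊥-elim (a≢b refl)
occurrences+2≤length {v = v} {us = u ∷ us} _ (here refl) (there b∈us) a≢v b≢v
  rewrite occurrences-other v u us a≢v = s≤s (occurrences<length b∈us b≢v)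
occurrences+2≤length {v = v} {us = u ∷ us} _ (there a∈us) (here refl) a≢v b≢v
  rewrite occurrences-other v u us b≢v = s≤s (occurrences<length a∈us a≢v)
occurrences+2≤length {v = v} {us = u ∷ us} a≢b (there a∈us) (there b∈us) a≢v b≢v with u ≟ v
... | yes _ = s≤s (occurrences+2≤length a≢b a∈us b∈us a≢v b≢v)
... | no _  = m≤n⇒m≤1+n (occurrences+2≤length a≢b a∈us b∈us a≢v b≢v)

no-occurrence⇒avoids : ∀ {m} (v : Fin m) us → occurrences v us ≡ 0 → All (_≢ v) us
no-occurrence⇒avoids v [] _ = []
no-occurrence⇒avoids v (u ∷ us) none with u ≟ v
... | no u≢v = u≢v ∷ no-occurrence⇒avoids v us none

evenAtMostOne : ∀ k → suc (suc (k + k)) ≤ 3 → k + k ≡ 0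
evenAtMostOne zero _ = refl
evenAtMostOne (suc k) (s≤s (s≤s (s≤s h))) = contradiction (subst (_≤ 0) (+-suc k k) h) λ ()

degree3-loopFree : ∀ {m} (E : EdgeList m) (v a b : Fin m) → deg v E ≡ 3 → a ≢ b →
  Neighbour E v a → Neighbour E v b → All (_≢ v) (nbrs v E)
degree3-loopFree E v a b deg3 a≢b (a≢v , a∈) (b≢v , b∈) with occurrences-even v E
... | k , even = no-occurrence⇒avoids v (nbrs v E) (trans even (evenAtMostOne k bound))
  where
  bound : suc (suc (k + k)) ≤ 3
  bound = subst₂ (λ s t → suc (suc s) ≤ t) even deg3 (occurrences+2≤length a≢b a∈ b∈ a≢v b≢v)

threeAvoiding : ∀ {n} {v : Fin (suc n)} (us : List (Fin (suc n))) → All (_≢ v) us → length us ≡ 3 →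
  ∃ λ x → ∃ λ y → ∃ λ z → us ≡ punchIn v x ∷ punchIn v y ∷ punchIn v z ∷ []
threeAvoiding (c₁ ∷ c₂ ∷ c₃ ∷ []) (c₁≢v ∷ c₂≢v ∷ c₃≢v ∷ []) refl =
  _ , _ , _ , cong₂ _∷_ (back c₁≢v) (cong₂ _∷_ (back c₂≢v) (cong (_∷ []) (back c₃≢v)))
  where
  back : ∀ {v c : Fin _} (c≢v : c ≢ v) → c ≡ punchIn v (punchOut (λ v≡c → c≢v (sym v≡c)))
  back c≢v = sym (punchIn-punchOut _)

allEqual-member : ∀ {m} {u w : Fin m} → u ∈ᴸ (w ∷ w ∷ w ∷ []) → u ≡ w
allEqual-member (here u≡w) = u≡w
allEqual-member (there (here u≡w)) = u≡w
allEqual-member (there (there (here u≡w))) = u≡w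

lemma5p10 : (n : ℕ) (E : EdgeList (suc n)) (v : Fin (suc n)) →
    IsP21 (suc n) E →
    deg v E ≡ 3 →
    ∃₂ (λ a b → a ≢ b × Neighbour E v a × Neighbour E v b) →
    Admissible n E v
lemma5p10 n E v ((_ , countE) , i₀ , (sparse₀ , _)) deg3 (a , b , a≢b , na@(_ , a∈) , nb@(_ , b∈)) =
  admissibleFrom (threeAvoiding (nbrs v E) noLoop deg3)
  where
  noLoop : All (_≢ v) (nbrs v E)
  noLoop = degree3-loopFree E v a b deg3 a≢b na nb
  admissibleFrom : (∃ λ x → ∃ λ y → ∃ λ z → nbrs v E ≡ punchIn v x ∷ punchIn v y ∷ punchIn v z ∷ []) →
    Admissible n E v
  admissibleFrom (x , y , z , nbrs≡) =
    Reduction.admissible E v i₀ (sparse⇒countSparse {2} {2} {suc n} {removeAt E i₀} sparse₀) countE noLoop deg3 x y z nbrs≡ notAllEqual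
    where
    notAllEqual : x ≡ y → x ≡ z → ⊥
    notAllEqual refl refl =
      a≢b (trans (allEqual-member (subst (a ∈ᴸ_) nbrs≡ a∈)) (sym (allEqual-member (subst (b ∈ᴸ_) nbrs≡ b∈))))
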